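{- Let $\mathcal{G}=(V,E,\lambda)$ be a simple temporal graph with lifetime $T_{\max}$, let $\delta\in\mathbb{N}^+$, and let $S\subseteq V\times[0,T_{\max}]$ be a set of seed infections. Let $L_1$ and $L_2$ be two infection logs that are both consistent with $S$. For $i=1,2$ let $T_i\coloneqq\{(v,t)\mid (u,v,t)\in L_i\}$ be the induced infection timetables. Then $T_1=T_2$.
   Context: A simple temporal graph $\mathcal{G}=(V,E,\lambda)$ with lifetime $T_{\max}\in\mathbb{N}$ consists of a finite undirected static graph $(V,E)$ and a labeling $\lambda:E\to[T_{\max}]=\{1,\dots,T_{\max}\}$; edge $e$ is present only at time step $\lambda(e)$. Infection model (SIR) with infectious period $\delta$: every node starts susceptible. A seed infection $(v,t)\in S$ makes $v$ infected at time $t$ (if it is still susceptible). Otherwise, a susceptible node $u$ becomes infected at time $t$ if and only if there is a node $v$ that is infectious at time $t$ and an edge $uv$ with $\lambda(uv)=t$; if several such neighbors exist, $u$ is infected by exactly one of them (any one). A node infected at time $t$ is infectious at time steps $t+1,\dots,t+\delta$ and resistant afterwards (it is never infected again). Such a process is an infection chain seeded with $S$. Its infection log is the set $L\subseteq V^2\times[0,T_{\max}]$ of triples $(u,v,t)$ meaning $u$ infected $v$ at time $t$, where a seed infection of $u$ at $t$ is recorded as $(u,u,t)$. An infection log is consistent with $S$ if some infection chain seeded with $S$ produces it. -}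

module Defs where

open import Data.Nat using (ℕ; _+_; _≤_; _<_)
open import Data.Fin using (Fin)
open import Data.Maybe using (Maybe; just; nothing)
open import Data.Product using (Σ; ∃; _×_)
open import Data.Sum using (_⊎_)
open import Relation.Nullary using (¬_)
open import Relation.Binary.PropositionalEquality using (_≡_)

-- A simple temporal graph on vertex set V = Fin n with lifetime Tmax.
-- lab u v ≡ just t  means uv ∈ E and λ(uv) = t;  lab u v ≡ nothing means uv ∉ E.
record TemporalGraph : Set where
  field
    n      : ℕ
    Tmax   : ℕ
    lab    : Fin n → Fin n → Maybe ℕ
    sym    : ∀ u v → lab u v ≡ lab v u
    noLoop : ∀ u → lab u u ≡ nothing
    range  : ∀ u v t → lab u v ≡ just t → 1 ≤ t × t ≤ Tmax

open TemporalGraph public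

V : TemporalGraph → Set
V G = Fin (n G)

-- A set of seed infections S ⊆ V × ℕ (as a predicate); boundedness by Tmax
-- is an explicit hypothesis of the theorem.
Seeds : TemporalGraph → Set₁
Seeds G = V G → ℕ → Set

-- An infection log L ⊆ V × V × ℕ (as a predicate): L u v t  means  (u,v,t) ∈ L.
Log : TemporalGraph → Set₁
Log G = V G → V G → ℕ → Set

module _ (G : TemporalGraph) (δ : ℕ) (L : Log G) where

  SusceptibleBefore : V G → ℕ → Set
  SusceptibleBefore v t = ∀ w t' → t' < t → ¬ L w v t'

  Infectious : V G → ℕ → Set
  Infectious u t = Σ (V G) λ w → Σ ℕ λ t' → L w u t' × t' < t × t ≤ t' + δ

  CanInfect : V G → V G → ℕ → Set
  CanInfect u v t = Infectious u t × lab G u v ≡ just t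

-- L is the infection log produced by some SIR infection chain on G with
-- infectious period δ seeded with S.  Since infections at time t depend only on
-- infections at times < t, a chain is fully recorded by its log; these are the
-- step rules of the process, stated on the log.
record ConsistentWith (G : TemporalGraph) (δ : ℕ) (S : Seeds G) (L : Log G) : Set where
  field
    -- every recorded infection is legal: the target was susceptible, and it is
    -- either a seed infection (recorded (v,v,t)) or, if (v,t) is not a seed,
    -- an infection by an infectious neighbour along an edge present at t
    sound : ∀ u v t → L u v t →
            SusceptibleBefore G δ L v t ×
            ((u ≡ v × S v t) ⊎ (¬ S v t × CanInfect G δ L u v t))
    unique : ∀ u u' v t → L u v t → L u' v t → u ≡ u'
    seedFires : ∀ v t → SusceptibleBefore G δ L v t → S v t → L v v t
    spreads : ∀ u v t → SusceptibleBefore G δ L v t → CanInfect G δ L u v t →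
              ∃ λ w → L w v t

Timetable : (G : TemporalGraph) → Log G → V G → ℕ → Set
Timetable G L v t = ∃ λ u → L u v t

{-# OPTIONS --safe #-}
module Submission where

-- Whether v is infected at time t is decided by the infections at earlier times alone:
-- v must still be susceptible, and then it is infected exactly when (v,t) is a seed or
-- some neighbour across an edge labelled t is infectious at t.  Two consistent logs
-- therefore agree on the infections at t as soon as they agree before t, and strong
-- induction on t makes their timetables equal.

open import Defs
open import Data.Nat using (ℕ; _≤_; _<_)
open import Data.Nat.Induction using (<-rec)
open import Data.Product using (_,_)
open import Data.Sum using (inj₁; inj₂)
open import Function.Bundles using (_⇔_; mk⇔; Equivalence)
import Function.Properties.Equivalence as ⇔

module _ (G : TemporalGraph) where

  AgreeAt : Log G → Log G → ℕ → Set
  AgreeAt L₁ L₂ t = ∀ v → Timetable G L₁ v t ⇔ Timetable G L₂ v t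

  AgreeBefore : Log G → Log G → ℕ → Set
  AgreeBefore L₁ L₂ t = ∀ {t'} → t' < t → AgreeAt L₁ L₂ t'

  agreeBefore-sym : ∀ {L₁ L₂ t} → AgreeBefore L₁ L₂ t → AgreeBefore L₂ L₁ t
  agreeBefore-sym agree t'<t v = ⇔.sym (agree t'<t v)

module _ {G : TemporalGraph} {δ : ℕ} {S : Seeds G} where

  susceptibleBefore-transfer : ∀ {L₁ L₂ v t} → AgreeBefore G L₁ L₂ t →
                               SusceptibleBefore G δ L₁ v t → SusceptibleBefore G δ L₂ v t
  susceptibleBefore-transfer {v = v} agree sus w t' t'<t infected₂
    with Equivalence.from (agree t'<t v) (w , infected₂)
  ... | w₁ , infected₁ = sus w₁ t' t'<t infected₁

  infectious-transfer : ∀ {L₁ L₂ u t} → AgreeBefore G L₁ L₂ t →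
                        Infectious G δ L₁ u t → Infectious G δ L₂ u t
  infectious-transfer {u = u} agree (w , t' , infected₁ , t'<t , t≤t'+δ)
    with Equivalence.to (agree t'<t u) (w , infected₁)
  ... | w₂ , infected₂ = w₂ , t' , infected₂ , t'<t , t≤t'+δ

  timetable-transfer : ∀ {L₁ L₂ t} → ConsistentWith G δ S L₁ → ConsistentWith G δ S L₂ →
                       AgreeBefore G L₁ L₂ t → ∀ v → Timetable G L₁ v t → Timetable G L₂ v t
  timetable-transfer {t = t} C₁ C₂ agree v (u , infected₁)
    with ConsistentWith.sound C₁ u v t infected₁
  ... | sus₁ , inj₁ (_ , seed) = v , ConsistentWith.seedFires C₂ v t sus₂ seed
    where sus₂ = susceptibleBefore-transfer agree sus₁
  ... | sus₁ , inj₂ (_ , infectious₁ , edge) =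
    ConsistentWith.spreads C₂ u v t sus₂ (infectious-transfer agree infectious₁ , edge)
    where sus₂ = susceptibleBefore-transfer agree sus₁

  agreeBefore⇒agreeAt : ∀ {L₁ L₂} → ConsistentWith G δ S L₁ → ConsistentWith G δ S L₂ →
            ∀ t → AgreeBefore G L₁ L₂ t → AgreeAt G L₁ L₂ t
  agreeBefore⇒agreeAt C₁ C₂ t agree v =
    mk⇔ (timetable-transfer C₁ C₂ agree v)
        (timetable-transfer C₂ C₁ (agreeBefore-sym G agree) v)

lemma1 : (G : TemporalGraph) (δ : ℕ) → 1 ≤ δ →
         (S : Seeds G) → (∀ v t → S v t → t ≤ Tmax G) →
         (L₁ L₂ : Log G) → ConsistentWith G δ S L₁ → ConsistentWith G δ S L₂ →
         ∀ v t → Timetable G L₁ v t ⇔ Timetable G L₂ v t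
lemma1 G δ _ S _ L₁ L₂ C₁ C₂ v t = <-rec (AgreeAt G L₁ L₂) (agreeBefore⇒agreeAt C₁ C₂) t v
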